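{- Every $1$-speed online algorithm for broadcast scheduling to minimize the maximum delay factor is $\Omega(n)$-competitive, where $n$ is the number of unit-sized pages; that is, there is an absolute constant $C>0$ such that for every (sufficiently large) $n$ and every online algorithm $A$ using a speed-$1$ machine, there is a request sequence over $n$ unit-sized pages on which the delay factor of $A$ is at least $Cn$ times the optimal offline delay factor.
   Context: Broadcast scheduling (pull model): there are $n$ distinct pages, each of unit size; requests arrive online, the $i$-th request for page $p$, $J_{(p,i)}$, having arrival time $a_{(p,i)}$ and deadline $d_{(p,i)}$. A single transmission of page $p$ satisfies all outstanding requests for $p$ that arrived before it; the finish time $f_{(p,i)}$ is the earliest time after $a_{(p,i)}$ at which page $p$ is completely transmitted. The delay factor of a schedule on $\sigma$ is $\max\{1,\max_{(p,i)}\frac{f_{(p,i)}-a_{(p,i)}}{d_{(p,i)}-a_{(p,i)}}\}$. The optimal offline schedule also uses a speed-$1$ machine. -}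

module Defs where

open import Data.Nat as ℕ using (ℕ; suc; _≤ᵇ_)
open import Data.Fin using (Fin)
open import Data.Maybe using (Maybe; just)
open import Data.List using (List; filter)
open import Data.List.Membership.Propositional using (_∈_)
open import Data.Integer using (+_)
open import Data.Rational using (ℚ; _/_; _*_; _≤_; _<_; 1ℚ)
open import Data.Product using (Σ; ∃; _×_)
open import Data.Sum using (_⊎_)
open import Relation.Binary.PropositionalEquality using (_≡_)
open import Relation.Nullary using (¬_)
open import Data.Bool using (T)
open import Relation.Unary using (Pred)

toℚ : ℕ → ℚ
toℚ k = + k / 1

record Request (n : ℕ) : Set where
  constructor req
  field
    page     : Fin n
    arrival  : ℕ
    deadline : ℕ
    a<d      : arrival ℕ.< deadline
open Request public

-- A (speed-1) schedule: in each unit time slot [t, t+1) the single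
-- machine broadcasts (transmits) one whole unit page, or idles.
-- A transmission in slot t finishes at time t+1 and satisfies every
-- outstanding request for that page with arrival ≤ t.
Schedule : ℕ → Set
Schedule n = ℕ → Maybe (Fin n)

Serves : ∀ {n} → Schedule n → Request n → ℕ → Set
Serves S j t = (arrival j ℕ.≤ t) × (S t ≡ just (page j))

-- Delay factor of S on σ is at most r:
--   max{1, max_j (f_j - a_j)/(d_j - a_j)} ≤ r,
-- i.e. 1 ≤ r and every request is finished (at time t+1 for some
-- serving slot t) with (f_j - a_j) ≤ r (d_j - a_j).
DelayFactor≤ : ∀ {n} → Schedule n → List (Request n) → ℚ → Set
DelayFactor≤ S σ r =
  (1ℚ ≤ r) ×
  (∀ j → j ∈ σ → ∃ λ t → Serves S j t ×
     (toℚ (suc t ℕ.∸ arrival j) ≤ r * toℚ (deadline j ℕ.∸ arrival j)))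

-- Delay factor of S on σ is at least r (possibly infinite):
--   r ≤ 1, or some request j is not finished before time a_j + r(d_j - a_j),
-- i.e. no slot t serving j has (t+1 - a_j) < r (d_j - a_j)
-- (this includes the case that j is never served, f_j = ∞).
DelayFactor≥ : ∀ {n} → Schedule n → List (Request n) → ℚ → Set
DelayFactor≥ S σ r =
  (r ≤ 1ℚ) ⊎
  (∃ λ j → (j ∈ σ) ×
     (∀ t → Serves S j t →
        ¬ (toℚ (suc t ℕ.∸ arrival j) < r * toℚ (deadline j ℕ.∸ arrival j))))

arrivedBy : ∀ {n} → ℕ → List (Request n) → List (Request n)
arrivedBy t = filter (λ j → arrival j ℕ.≤? t)

-- A deterministic online algorithm (speed 1): at each slot t it decides
-- what to broadcast based only on the requests arrived so far (pages,
-- arrival times and deadlines are revealed on arrival); its own past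
-- decisions are a function of this information.
OnlineAlgorithm : ℕ → Set
OnlineAlgorithm n = ℕ → List (Request n) → Maybe (Fin n)

run : ∀ {n} → OnlineAlgorithm n → List (Request n) → Schedule n
run A σ t = A t (arrivedBy t σ)

-- For an online algorithm A and m = K + 1 with 3m ≤ n, the adversary releases 2m pages at time 0 with
-- deadline 2m, re-requests at time m (deadline 2m) every page A broadcast before m, and from time 2m on
-- releases at each step 2m + k, for 2mK steps, a request with slack 1 for page 2m + (k mod m).
-- Offline, broadcasting the burst pages untouched by A (at least m of them) first, then the re-requested
-- ones, then each stream request on arrival, achieves delay factor 1.
-- Online, the first m slots are wasted. Within delay factor K, the last request of each burst page and
-- every stream request would each need its own slot in [m, 2m + 2mK + K): their pages differ, and stream
-- requests for the same page arrive m apart while each may wait only K < m. That is 2m + 2mK requests in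
-- m + 2mK + K slots, impossible. With K = ⌊n/8⌋ the ratio K is at least n/16.

module Submission where

open import Data.Nat as ℕ
  using (ℕ; zero; suc; _+_; _*_; _∸_; _≤_; _<_; _≥_; _≤′_; ≤′-refl; ≤′-step; z≤n; z<s; s≤s⁻¹; _≤?_; _<?_; NonZero)
open import Data.Nat.Properties
open import Data.Nat.DivMod using (_%_; _/_; m≡m%n+[m/n]*n; m%n<n; m/n*n≤m; /-mono-≤)
open import Data.Nat.Tactic.RingSolver using (solve-∀)
import Data.Integer as ℤ
import Data.Integer.Properties as ℤ
open import Data.Rational as ℚ using (ℚ; mkℚ; 0ℚ; 1ℚ; *≤*; *<*)
import Data.Rational.Properties as ℚ
import Data.Rational.Unnormalised as ℚᵘ
import Data.Rational.Unnormalised.Properties as ℚᵘ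
import Data.Nat.Coprimality as Coprimality
open import Data.Fin as Fin using (Fin; toℕ; fromℕ<; splitAt; join)
open import Data.Fin.Properties using (toℕ<n; toℕ-fromℕ<; toℕ-injective; fromℕ<-injective; injective⇒≤; ¬∀⟶∃¬; join-splitAt)
open import Data.Maybe using (just; nothing)
open import Data.Maybe.Properties as Maybe using (just-injective)
open import Data.List using (List; []; _++_; map; filter; upTo)
open import Data.List.Properties using (filter-++; filter-none; ++-identityʳ)
open import Data.List.Membership.Propositional using (_∈_)
open import Data.List.Membership.Propositional.Properties
  using (∈-map⁺; ∈-map⁻; ∈-++⁺ˡ; ∈-++⁺ʳ; ∈-++⁻; ∈-filter⁺; ∈-filter⁻; ∈-upTo⁺; ∈-upTo⁻)
open import Data.List.Relation.Unary.All using (All; universal)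
open import Data.List.Relation.Unary.All.Properties using (map⁺; ++⁺)
open import Data.Product using (∃; _×_; _,_; proj₁; proj₂)
open import Data.Sum using (_⊎_; inj₁; inj₂; [_,_]′)
open import Function using (_∘_)
open import Relation.Nullary using (¬_; Dec; yes; no; contradiction)
open import Relation.Nullary.Decidable using (_×-dec_; map′)
open import Relation.Unary using (Pred; Decidable)
open import Relation.Unary.Properties using (∁?)
open import Relation.Binary using (tri<; tri≈; tri>)
open import Relation.Binary.PropositionalEquality

open import Defs

toℚ≡mkℚ : ∀ k → toℚ k ≡ mkℚ (ℤ.+ k) 0 (Coprimality.sym (Coprimality.1-coprimeTo k))
toℚ≡mkℚ k = ℚ.normalize-coprime _

toℚ-mono-≤ : ∀ {a b} → a ≤ b → toℚ a ℚ.≤ toℚ b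
toℚ-mono-≤ {a} {b} a≤b rewrite toℚ≡mkℚ a | toℚ≡mkℚ b =
  *≤* (subst₂ ℤ._≤_ (sym (ℤ.*-identityʳ (ℤ.+ a))) (sym (ℤ.*-identityʳ (ℤ.+ b))) (ℤ.+≤+ a≤b))

toℚ-cancel-< : ∀ {a b} → toℚ a ℚ.< toℚ b → a < b
toℚ-cancel-< {a} {b} a<b rewrite toℚ≡mkℚ a | toℚ≡mkℚ b with a<b
... | *<* a*1<b*1 = ℤ.drop‿+<+ (subst₂ ℤ._<_ (ℤ.*-identityʳ (ℤ.+ a)) (ℤ.*-identityʳ (ℤ.+ b)) a*1<b*1)

toℚ-nonNeg : ∀ k → ℚ.NonNegative (toℚ k)
toℚ-nonNeg k rewrite toℚ≡mkℚ k = _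

toℚ-homo-* : ∀ a b → toℚ (a * b) ≡ toℚ a ℚ.* toℚ b
toℚ-homo-* a b = ℚ.toℚᵘ-injective (ℚᵘ.≃-sym (ℚᵘ.≃-trans (ℚ.toℚᵘ-homo-* (toℚ a) (toℚ b)) ≃-on-mkℚ))
  where
  ≃-on-mkℚ : ℚ.toℚᵘ (toℚ a) ℚᵘ.* ℚ.toℚᵘ (toℚ b) ℚᵘ.≃ ℚ.toℚᵘ (toℚ (a * b))
  ≃-on-mkℚ rewrite toℚ≡mkℚ a | toℚ≡mkℚ b | toℚ≡mkℚ (a * b) = ℚᵘ.*≡* (cong (ℤ._* ℤ.+ 1) (sym (ℤ.pos-* a b)))

toℚ-≤-1* : ∀ {x s} → x ≤ s → toℚ x ℚ.≤ 1ℚ ℚ.* toℚ s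
toℚ-≤-1* {x} {s} x≤s = subst (toℚ x ℚ.≤_) (sym (ℚ.*-identityˡ (toℚ s))) (toℚ-mono-≤ x≤s)

toℚ-cancel-<-* : ∀ {r x s} K → r ℚ.≤ toℚ K → toℚ x ℚ.< r ℚ.* toℚ s → x < K * s
toℚ-cancel-<-* {r} {x} {s} K r≤K x<rs = toℚ-cancel-< (begin-strict
    toℚ x           <⟨ x<rs ⟩
    r ℚ.* toℚ s     ≤⟨ ℚ.*-monoʳ-≤-nonNeg (toℚ s) {{toℚ-nonNeg s}} r≤K ⟩
    toℚ K ℚ.* toℚ s ≡⟨ toℚ-homo-* K s ⟨
    toℚ (K * s)     ∎)
  where open ℚ.≤-Reasoning

suc∸<⇒<+ : ∀ {a t x} → a ≤ t → suc t ∸ a < x → t < a + x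
suc∸<⇒<+ {a} {t} {x} a≤t t+1∸a<x = subst (_< a + x) (m+[n∸m]≡n a≤t)
  (+-monoʳ-< a (<-trans (n<1+n (t ∸ a)) (subst (_< x) (+-∸-assoc 1 a≤t) t+1∸a<x)))

count : ∀ {p} {P : Pred ℕ p} → Decidable P → ℕ → ℕ
count P? zero = zero
count P? (suc k) with P? k
... | yes _ = suc (count P? k)
... | no  _ = count P? k

module _ {p} {P : Pred ℕ p} (P? : Decidable P) where

  count-≤-suc : ∀ k → count P? k ≤ count P? (suc k)
  count-≤-suc k with P? k
  ... | yes _ = n≤1+n _
  ... | no  _ = ≤-refl

  count-mono-≤ : ∀ {i j} → i ≤ j → count P? i ≤ count P? j
  count-mono-≤ i≤j = count-mono-≤′ (≤⇒≤′ i≤j)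
    where
    count-mono-≤′ : ∀ {i j} → i ≤′ j → count P? i ≤ count P? j
    count-mono-≤′ ≤′-refl       = ≤-refl
    count-mono-≤′ (≤′-step i≤j) = ≤-trans (count-mono-≤′ i≤j) (count-≤-suc _)

  count-< : ∀ {i j} → P i → i < j → count P? i < count P? j
  count-< {i} Pi i<j = ≤-trans count-<-suc (count-mono-≤ i<j)
    where
    count-<-suc : count P? i < count P? (suc i)
    count-<-suc with P? i
    ... | yes _  = ≤-refl
    ... | no ¬Pi = contradiction Pi ¬Pi

  count-injective : ∀ {i j} → P i → P j → count P? i ≡ count P? j → i ≡ j
  count-injective {i} {j} Pi Pj eq with <-cmp i j
  ... | tri< i<j _ _ = contradiction eq (<⇒≢ (count-< Pi i<j))
  ... | tri≈ _ i≡j _ = i≡j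
  ... | tri> _ _ j<i = contradiction eq (≢-sym (<⇒≢ (count-< Pj j<i)))

  count-select : ∀ {r k} → r < count P? k → ∃ λ i → i < k × P i × count P? i ≡ r
  count-select {r} {suc k} r<c with P? k
  ... | no _ = let (i , i<k , Pi , ci≡r) = count-select r<c in i , m<n⇒m<1+n i<k , Pi , ci≡r
  ... | yes Pk with m≤n⇒m<n∨m≡n (s≤s⁻¹ r<c)
  ...   | inj₁ r<c′ = let (i , i<k , Pi , ci≡r) = count-select r<c′ in i , m<n⇒m<1+n i<k , Pi , ci≡r
  ...   | inj₂ refl = k , ≤-refl , Pk , refl

  count+count∁ : ∀ k → count P? k + count (∁? P?) k ≡ k
  count+count∁ zero = refl
  count+count∁ (suc k) with P? k
  ... | yes _ = cong suc (count+count∁ k)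
  ... | no  _ = trans (+-suc _ _) (cong suc (count+count∁ k))

  count-≤-injection : ∀ {k M} (f : ∀ {i} → i < k → P i → Fin M) →
    (∀ {i j} (i<k : i < k) (j<k : j < k) (Pi : P i) (Pj : P j) → f i<k Pi ≡ f j<k Pj → i ≡ j) →
    count P? k ≤ M
  count-≤-injection {k} {M} f f-injective = injective⇒≤ {f = f∘select} f∘select-injective
    where
    select : (r : Fin (count P? k)) → ∃ λ i → i < k × P i × count P? i ≡ toℕ r
    select r = count-select (toℕ<n r)
    f∘select : Fin (count P? k) → Fin M
    f∘select r = let (_ , i<k , Pi , _) = select r in f i<k Pi
    f∘select-injective : ∀ {r s} → f∘select r ≡ f∘select s → r ≡ s
    f∘select-injective {r} {s} eq = toℕ-injective (begin
      toℕ r                       ≡⟨ proj₂ (proj₂ (proj₂ (select r))) ⟨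
      count P? (proj₁ (select r)) ≡⟨ cong (count P?) (f-injective _ _ _ _ eq) ⟩
      count P? (proj₁ (select s)) ≡⟨ proj₂ (proj₂ (proj₂ (select s))) ⟩
      toℕ s                       ∎)
      where open ≡-Reasoning

module StablePartition {p} {P : Pred ℕ p} (P? : Decidable P) (b : ℕ) where

  rank : ℕ → ℕ
  rank i with P? i
  ... | yes _ = count (∁? P?) b + count P? i
  ... | no  _ = count (∁? P?) i

  rank-P : ∀ {i} → P i → count (∁? P?) b ≤ rank i
  rank-P {i} Pi with P? i
  ... | yes _  = m≤m+n _ _
  ... | no ¬Pi = contradiction Pi ¬Pi

  rank-< : ∀ {i} → i < b → rank i < b
  rank-< {i} i<b with P? i
  ... | yes Pi = subst (count (∁? P?) b + count P? i <_)
                   (trans (+-comm (count (∁? P?) b) (count P? b)) (count+count∁ P? b))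
                   (+-monoʳ-< (count (∁? P?) b) (count-< P? Pi i<b))
  ... | no ¬Pi = ≤-trans (count-< (∁? P?) ¬Pi i<b) (subst (count (∁? P?) b ≤_) (count+count∁ P? b) (m≤n+m _ _))

  rank-injective : ∀ {i j} → i < b → j < b → rank i ≡ rank j → i ≡ j
  rank-injective {i} {j} i<b j<b eq with P? i | P? j
  ... | yes Pi | yes Pj = count-injective P? Pi Pj (+-cancelˡ-≡ _ _ _ eq)
  ... | no ¬Pi | no ¬Pj = count-injective (∁? P?) ¬Pi ¬Pj eq
  ... | yes Pi | no ¬Pj = contradiction eq (≢-sym (<⇒≢ (<-≤-trans (count-< (∁? P?) ¬Pj j<b) (m≤m+n _ _))))
  ... | no ¬Pi | yes Pj = contradiction eq (<⇒≢ (<-≤-trans (count-< (∁? P?) ¬Pi i<b) (m≤m+n _ _)))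

%≡%∧<⇒+≤ : ∀ {i j m} .{{_ : NonZero m}} → i % m ≡ j % m → i < j → i + m ≤ j
%≡%∧<⇒+≤ {i} {j} {m} i%m≡j%m i<j = begin
    i + m                      ≡⟨ cong (_+ m) (m≡m%n+[m/n]*n i m) ⟩
    i % m + i / m * m + m      ≡⟨ +-assoc (i % m) (i / m * m) m ⟩
    i % m + (i / m * m + m)    ≡⟨ cong ((i % m) +_) (+-comm (i / m * m) m) ⟩
    i % m + suc (i / m) * m    ≤⟨ +-monoʳ-≤ (i % m) (*-monoˡ-≤ m quotient-<) ⟩
    i % m + j / m * m          ≡⟨ cong (_+ j / m * m) i%m≡j%m ⟩
    j % m + j / m * m          ≡⟨ m≡m%n+[m/n]*n j m ⟨
    j                          ∎
  where
  open ≤-Reasoning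
  quotient-< : i / m < j / m
  quotient-< = *-cancelʳ-< m (i / m) (j / m) (+-cancelˡ-< (i % m) _ _
    (subst₂ _<_ (m≡m%n+[m/n]*n i m) (trans (m≡m%n+[m/n]*n j m) (cong (_+ j / m * m) (sym i%m≡j%m))) i<j))

%-injective-near : ∀ {i j m} .{{_ : NonZero m}} → i % m ≡ j % m → i < j + m → j < i + m → i ≡ j
%-injective-near {i} {j} eq i<j+m j<i+m with <-cmp i j
... | tri< i<j _ _ = contradiction (%≡%∧<⇒+≤ eq i<j) (<⇒≱ j<i+m)
... | tri≈ _ i≡j _ = i≡j
... | tri> _ _ j<i = contradiction (%≡%∧<⇒+≤ (sym eq) j<i) (<⇒≱ i<j+m)

module Adversary {n : ℕ} (A : OnlineAlgorithm n) (K : ℕ) (room : suc K + suc K + suc K ≤ n) where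

  m burst L : ℕ
  m     = suc K
  burst = m + m
  L     = K * burst

  burst≤n : burst ≤ n
  burst≤n = ≤-trans (m≤m+n burst m) room

  pg : ℕ → Fin n
  pg i with i <? n
  ... | yes i<n = fromℕ< i<n
  ... | no  _   = fromℕ< (<-≤-trans z<s room)   -- junk: only pages below n are ever used

  toℕ-pg : ∀ {i} → i < n → toℕ (pg i) ≡ i
  toℕ-pg {i} i<n with i <? n
  ... | yes _    = toℕ-fromℕ< _
  ... | no  i≮n = contradiction i<n i≮n

  pg-injective : ∀ {i j} → i < n → j < n → pg i ≡ pg j → i ≡ j
  pg-injective i<n j<n eq = trans (sym (toℕ-pg i<n)) (trans (cong toℕ eq) (toℕ-pg j<n))

  initial repeat stream : ℕ → Request n
  initial g = req (pg g) 0 burst z<s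
  repeat  g = req (pg g) m burst (m<m+n m z<s)
  stream  k = req (pg (burst + k % m)) (burst + k) (suc (burst + k)) ≤-refl

  σ₀ : List (Request n)
  σ₀ = map initial (upTo burst)

  A₀ : Schedule n
  A₀ = run A σ₀

  Early : Pred ℕ _
  Early g = ∃ λ i → i < m × A₀ i ≡ just (pg g)

  early? : Decidable Early
  early? g = anyUpTo? (λ i → Maybe.≡-dec Fin._≟_ (A₀ i) (just (pg g))) m

  later : List (Request n)
  later = map repeat (filter early? (upTo burst)) ++ map stream (upTo L)

  σ : List (Request n)
  σ = σ₀ ++ later

  data Released : Request n → Set where
    is-initial : ∀ {g} → g < burst → Released (initial g)
    is-repeat  : ∀ {g} → g < burst → Early g → Released (repeat g)
    is-stream  : ∀ {k} → k < L → Released (stream k)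

  ∈σ⇒Released : ∀ {j} → j ∈ σ → Released j
  ∈σ⇒Released j∈σ with ∈-++⁻ σ₀ j∈σ
  ... | inj₁ j∈σ₀ with ∈-map⁻ initial j∈σ₀
  ...   | g , g∈ , refl = is-initial (∈-upTo⁻ g∈)
  ∈σ⇒Released j∈σ | inj₂ j∈later with ∈-++⁻ (map repeat (filter early? (upTo burst))) j∈later
  ... | inj₁ j∈repeats with ∈-map⁻ repeat j∈repeats
  ...   | g , g∈ , refl = let (g∈′ , early) = ∈-filter⁻ early? g∈ in is-repeat (∈-upTo⁻ g∈′) early
  ∈σ⇒Released j∈σ | inj₂ j∈later | inj₂ j∈streams with ∈-map⁻ stream j∈streams
  ... | k , k∈ , refl = is-stream (∈-upTo⁻ k∈)

  count-early≤m : count early? burst ≤ m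
  count-early≤m = count-≤-injection early? (λ _ (i , i<m , _) → fromℕ< i<m) broadcast-slot-injective
    where
    broadcast-slot-injective : ∀ {g h} (g<b : g < burst) (h<b : h < burst) (eg : Early g) (eh : Early h) →
      fromℕ< (proj₁ (proj₂ eg)) ≡ fromℕ< (proj₁ (proj₂ eh)) → g ≡ h
    broadcast-slot-injective {g} {h} g<b h<b (i , _ , A₀i≡g) (i′ , _ , A₀i′≡h) eq =
      pg-injective (<-≤-trans g<b burst≤n) (<-≤-trans h<b burst≤n) (just-injective (begin
        just (pg g) ≡⟨ A₀i≡g ⟨
        A₀ i        ≡⟨ cong A₀ (fromℕ<-injective i i′ _ _ eq) ⟩
        A₀ i′       ≡⟨ A₀i′≡h ⟩
        just (pg h) ∎))
      where open ≡-Reasoning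

  open StablePartition early? burst using (rank; rank-P; rank-<; rank-injective)

  m≤rank-early : ∀ {g} → Early g → m ≤ rank g
  m≤rank-early {g} early = ≤-trans m≤count∁early (rank-P early)
    where
    m≤count∁early : m ≤ count (∁? early?) burst
    m≤count∁early = +-cancelˡ-≤ (count early? burst) m _
      (subst (count early? burst + m ≤_) (sym (count+count∁ early? burst)) (+-monoˡ-≤ m count-early≤m))

  opt : Schedule n
  opt t with t <? burst
  ... | no  _ = just (page (stream (t ∸ burst)))
  ... | yes _ with anyUpTo? (λ g → rank g ℕ.≟ t) burst
  ...   | yes (g , _ , _) = just (pg g)
  ...   | no  _           = nothing   -- unreachable: rank is a bijection on [0, burst)

  opt-rank : ∀ {g} → g < burst → opt (rank g) ≡ just (pg g)
  opt-rank {g} g<b with rank g <? burst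
  ... | no  r≮b = contradiction (rank-< g<b) r≮b
  ... | yes _ with anyUpTo? (λ h → rank h ℕ.≟ rank g) burst
  ...   | yes (h , h<b , rh≡rg) = cong (just ∘ pg) (rank-injective h<b g<b rh≡rg)
  ...   | no  none              = contradiction (g , g<b , refl) none

  opt-stream : ∀ k → opt (burst + k) ≡ just (page (stream k))
  opt-stream k with burst + k <? burst
  ... | yes b+k<b = contradiction (m≤m+n burst k) (<⇒≱ b+k<b)
  ... | no  _     = cong (just ∘ page ∘ stream) (m+n∸m≡n burst k)

  opt-delayFactor≤1 : DelayFactor≤ opt σ 1ℚ
  opt-delayFactor≤1 = ℚ.≤-refl , λ j j∈σ → on-time (∈σ⇒Released j∈σ)
    where
    on-time : ∀ {j} → Released j →
      ∃ λ t → Serves opt j t × toℚ (suc t ∸ arrival j) ℚ.≤ 1ℚ ℚ.* toℚ (deadline j ∸ arrival j)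
    on-time (is-initial g<b)     = rank _ , (z≤n , opt-rank g<b) , toℚ-≤-1* (rank-< g<b)
    on-time (is-repeat g<b early) =
      rank _ , (m≤rank-early early , opt-rank g<b) , toℚ-≤-1* (∸-monoˡ-≤ m (rank-< g<b))
    on-time (is-stream {k} _)    = burst + k , (≤-refl , opt-stream k) , toℚ-≤-1* (≤-refl {suc (burst + k) ∸ (burst + k)})

  S : Schedule n
  S = run A σ

  S-agrees : ∀ {t} → t < m → S t ≡ A₀ t
  S-agrees {t} t<m = cong (A t) (begin
      arrivedBy t σ                       ≡⟨ filter-++ (λ j → arrival j ≤? t) σ₀ later ⟩
      arrivedBy t σ₀ ++ arrivedBy t later ≡⟨ cong (arrivedBy t σ₀ ++_) (filter-none (λ j → arrival j ≤? t) not-arrived) ⟩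
      arrivedBy t σ₀ ++ []                ≡⟨ ++-identityʳ _ ⟩
      arrivedBy t σ₀                      ∎)
    where
    open ≡-Reasoning
    not-arrived : All (λ j → ¬ arrival j ≤ t) later
    not-arrived = ++⁺ (map⁺ (universal (λ _ → <⇒≱ t<m) (filter early? (upTo burst))))
                      (map⁺ (universal (λ k → <⇒≱ (<-≤-trans t<m (≤-trans (m≤m+n m m) (m≤m+n burst k)))) (upTo L)))

  stretched : Request n → ℕ
  stretched j = arrival j + K * (deadline j ∸ arrival j)

  FastAt : Request n → ℕ → Set
  FastAt j t = t < stretched j × Serves S j t

  fastAt? : ∀ j → Decidable (λ t → FastAt j t)
  fastAt? j t = (t <? stretched j) ×-dec ((arrival j ≤? t) ×-dec Maybe.≡-dec Fin._≟_ (S t) (just (page j)))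

  ServedFast : Request n → Set
  ServedFast j = ∃ (FastAt j)

  servedFast? : ∀ j → Dec (ServedFast j)
  servedFast? j = map′ (λ (t , _ , fast) → t , fast) (λ (t , fast) → t , proj₁ fast , fast)
    (anyUpTo? (fastAt? j) (stretched j))

  stretched-stream : ∀ k → stretched (stream k) ≡ burst + k + K
  stretched-stream k = cong (burst + k +_) (trans (cong (K *_) unit-slack) (*-identityʳ K))
    where
    unit-slack : suc (burst + k) ∸ (burst + k) ≡ 1
    unit-slack = trans (+-∸-assoc 1 (≤-refl {burst + k})) (cong suc (n∸n≡0 (burst + k)))

  burstItem : ℕ → Request n
  burstItem g with early? g
  ... | yes _ = repeat g
  ... | no  _ = initial g

  item : Fin burst ⊎ Fin L → Request n
  item = [ burstItem ∘ toℕ , stream ∘ toℕ ]′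

  item-∈σ : ∀ x → item x ∈ σ
  item-∈σ (inj₁ g) with early? (toℕ g)
  ... | yes early = ∈-++⁺ʳ σ₀ (∈-++⁺ˡ (∈-map⁺ repeat (∈-filter⁺ early? (∈-upTo⁺ (toℕ<n g)) early)))
  ... | no  _     = ∈-++⁺ˡ (∈-map⁺ initial (∈-upTo⁺ (toℕ<n g)))
  item-∈σ (inj₂ k) = ∈-++⁺ʳ σ₀ (∈-++⁺ʳ (map repeat (filter early? (upTo burst))) (∈-map⁺ stream (∈-upTo⁺ (toℕ<n k))))

  pageIndex : Fin burst ⊎ Fin L → ℕ
  pageIndex = [ toℕ , (λ k → burst + toℕ k % m) ]′

  page-item : ∀ x → page (item x) ≡ pg (pageIndex x)
  page-item (inj₁ g) with early? (toℕ g)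
  ... | yes _ = refl
  ... | no  _ = refl
  page-item (inj₂ _) = refl

  pageIndex<n : ∀ x → pageIndex x < n
  pageIndex<n (inj₁ g) = <-≤-trans (toℕ<n g) burst≤n
  pageIndex<n (inj₂ k) = <-≤-trans (+-monoʳ-< burst (m%n<n (toℕ k) m)) room

  slots : ℕ
  slots = m + L + K

  L≤slots : L ≤ slots
  L≤slots = ≤-trans (m≤n+m L m) (m≤m+n (m + L) K)

  slots<burst+L : slots < burst + L
  slots<burst+L = ≤-reflexive (begin
    suc (m + L + K) ≡⟨ cong suc (+-comm (m + L) K) ⟩
    m + (m + L)     ≡⟨ +-assoc m m L ⟨
    burst + L       ∎)
    where open ≡-Reasoning

  fastAt-window : ∀ x {t} → FastAt (item x) t → m ≤ t × t < m + slots
  fastAt-window (inj₁ g) {t} (t< , a≤t , St) with early? (toℕ g)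
  ... | yes _ = a≤t , <-≤-trans t< (+-monoʳ-≤ m (begin
      K * (burst ∸ m) ≡⟨ cong (K *_) (m+n∸m≡n m m) ⟩
      K * m           ≤⟨ *-monoʳ-≤ K (m≤m+n m m) ⟩
      L               ≤⟨ L≤slots ⟩
      slots           ∎))
    where open ≤-Reasoning
  ... | no ¬early = m≤t , <-≤-trans t< (≤-trans L≤slots (m≤n+m slots m))
    where
    m≤t : m ≤ t
    m≤t with m ≤? t
    ... | yes m≤t = m≤t
    ... | no  m≰t = contradiction (t , ≰⇒> m≰t , trans (sym (S-agrees (≰⇒> m≰t))) St) ¬early
  fastAt-window (inj₂ k) {t} (t< , a≤t , _) =
    ≤-trans (≤-trans (m≤m+n m m) (m≤m+n burst (toℕ k))) a≤t ,
    (begin-strict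
      t                   <⟨ subst (t <_) (stretched-stream (toℕ k)) t< ⟩
      burst + toℕ k + K   ≤⟨ +-monoˡ-≤ K (+-monoʳ-≤ burst (<⇒≤ (toℕ<n k))) ⟩
      burst + L + K       ≡⟨ cong (_+ K) (+-assoc m m L) ⟩
      m + (m + L) + K     ≡⟨ +-assoc m (m + L) K ⟩
      m + slots           ∎)
    where open ≤-Reasoning

  stream-fastAt-injective : ∀ {k k′ t} → k % m ≡ k′ % m → FastAt (stream k) t → FastAt (stream k′) t → k ≡ k′
  stream-fastAt-injective {k} {k′} {t} k≡k′ (tk< , bk≤t , _) (tk′< , bk′≤t , _) =
    %-injective-near k≡k′ (near bk≤t tk′<) (near bk′≤t tk<)
    where
    near : ∀ {i j} → burst + i ≤ t → t < stretched (stream j) → i < j + m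
    near {i} {j} b+i≤t t< = +-cancelˡ-< burst i (j + m) (begin-strict
      burst + i       ≤⟨ b+i≤t ⟩
      t               <⟨ subst (t <_) (stretched-stream j) t< ⟩
      burst + j + K   ≤⟨ +-monoʳ-≤ (burst + j) (n≤1+n K) ⟩
      burst + j + m   ≡⟨ +-assoc burst j m ⟩
      burst + (j + m) ∎)
      where open ≤-Reasoning

  fastAt-injective : ∀ x y {t} → FastAt (item x) t → FastAt (item y) t → x ≡ y
  fastAt-injective x y fx@(_ , _ , Sx) fy@(_ , _ , Sy) = same-page x y fx fy
    (pg-injective (pageIndex<n x) (pageIndex<n y)
      (trans (sym (page-item x)) (trans (just-injective (trans (sym Sx) Sy)) (page-item y))))
    where
    same-page : ∀ x y {t} → FastAt (item x) t → FastAt (item y) t → pageIndex x ≡ pageIndex y → x ≡ y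
    same-page (inj₁ g) (inj₁ h) _ _ eq = cong inj₁ (toℕ-injective eq)
    same-page (inj₁ g) (inj₂ k) _ _ eq = contradiction (toℕ<n g) (≤⇒≯ (subst (burst ≤_) (sym eq) (m≤m+n burst _)))
    same-page (inj₂ k) (inj₁ h) _ _ eq = contradiction (toℕ<n h) (≤⇒≯ (subst (burst ≤_) eq (m≤m+n burst _)))
    same-page (inj₂ k) (inj₂ k′) fk fk′ eq =
      cong inj₂ (toℕ-injective (stream-fastAt-injective (+-cancelˡ-≡ burst _ _ eq) fk fk′))

  some-item-slow : ∃ λ x → ¬ ServedFast (item x)
  some-item-slow =
    let (i , slow) = ¬∀⟶∃¬ (burst + L) (ServedFast ∘ item ∘ splitAt burst) (servedFast? ∘ item ∘ splitAt burst) not-all-fast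
    in splitAt burst i , slow
    where
    not-all-fast : ¬ (∀ i → ServedFast (item (splitAt burst i)))
    not-all-fast fast = <⇒≱ slots<burst+L (injective⇒≤ {f = slot} slot-injective)
      where
      time : Fin (burst + L) → ℕ
      time i = proj₁ (fast i)

      window : ∀ i → m ≤ time i × time i < m + slots
      window i = fastAt-window (splitAt burst i) (proj₂ (fast i))

      slot : Fin (burst + L) → Fin slots
      slot i = fromℕ< (subst (time i ∸ m <_) (m+n∸m≡n m slots) (∸-monoˡ-< (proj₂ (window i)) (proj₁ (window i))))

      time-injective : ∀ {i j} → time i ≡ time j → i ≡ j
      time-injective {i} {j} tᵢ≡tⱼ = begin
        i                              ≡⟨ join-splitAt burst L i ⟨
        join burst L (splitAt burst i) ≡⟨ cong (join burst L) (fastAt-injective (splitAt burst i) (splitAt burst j)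
                                            (proj₂ (fast i)) (subst (FastAt (item (splitAt burst j))) (sym tᵢ≡tⱼ) (proj₂ (fast j)))) ⟩
        join burst L (splitAt burst j) ≡⟨ join-splitAt burst L j ⟩
        j                              ∎
        where open ≡-Reasoning

      slot-injective : ∀ {i j} → slot i ≡ slot j → i ≡ j
      slot-injective {i} {j} eq = time-injective (∸-cancelʳ-≡ (proj₁ (window i)) (proj₁ (window j))
        (fromℕ<-injective _ _ _ _ eq))

  online-delayFactor≥ : ∀ {r} → r ℚ.≤ toℚ K → DelayFactor≥ S σ r
  online-delayFactor≥ r≤K =
    let (x , slow) = some-item-slow
    in inj₂ (item x , item-∈σ x , λ t served t<r·slack →
         slow (t , suc∸<⇒<+ (proj₁ served) (toℚ-cancel-<-* K r≤K t<r·slack) , served))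

C : ℚ
C = ℤ.+ 1 ℚ./ 16

C-pos : 0ℚ ℚ.< C
C-pos = *<* (ℤ.+<+ z<s)

C*n≤K : ∀ {n K} → n ≤ 16 * K → C ℚ.* toℚ n ℚ.* 1ℚ ℚ.≤ toℚ K
C*n≤K {n} {K} n≤16K = begin
  C ℚ.* toℚ n ℚ.* 1ℚ          ≡⟨ ℚ.*-identityʳ (C ℚ.* toℚ n) ⟩
  C ℚ.* toℚ n                 ≤⟨ ℚ.*-monoˡ-≤-nonNeg C (toℚ-mono-≤ n≤16K) ⟩
  C ℚ.* toℚ (16 * K)          ≡⟨ cong (C ℚ.*_) (toℚ-homo-* 16 K) ⟩
  C ℚ.* (toℚ 16 ℚ.* toℚ K)    ≡⟨ ℚ.*-assoc C (toℚ 16) (toℚ K) ⟨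
  C ℚ.* toℚ 16 ℚ.* toℚ K      ≡⟨ ℚ.*-identityˡ (toℚ K) ⟩   -- C ℚ.* toℚ 16 computes to 1ℚ
  toℚ K                       ∎
  where open ℚ.≤-Reasoning

module _ (n : ℕ) (8≤n : 8 ≤ n) where

  private
    q : ℕ
    q = n / 8

    1≤q : 1 ≤ q
    1≤q = /-mono-≤ {o = 8} {p = 8} 8≤n ≤-refl

  eighth-room : suc q + suc q + suc q ≤ n
  eighth-room = ≤-trans (three-q+1≤eight-q 1≤q) (m/n*n≤m n 8)
    where
    three-q+1≤eight-q : ∀ {q} → 1 ≤ q → suc q + suc q + suc q ≤ q * 8
    three-q+1≤eight-q {suc r} _ = begin
      suc (suc r) + suc (suc r) + suc (suc r) ≡⟨ normalise r ⟩
      6 + r * 3                               ≤⟨ +-mono-≤ (≤-trans (n≤1+n 6) (n≤1+n 7)) (*-monoʳ-≤ r (m≤m+n 3 5)) ⟩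
      8 + r * 8                               ∎
      where
      open ≤-Reasoning
      normalise : ∀ r → suc (suc r) + suc (suc r) + suc (suc r) ≡ 6 + r * 3
      normalise = solve-∀

  n≤16*eighth : n ≤ 16 * q
  n≤16*eighth = begin
    n                ≡⟨ m≡m%n+[m/n]*n n 8 ⟩
    n % 8 + q * 8    ≤⟨ +-monoˡ-≤ (q * 8) (≤-trans (<⇒≤ (m%n<n n 8)) (*-monoˡ-≤ 8 1≤q)) ⟩
    q * 8 + q * 8    ≡⟨ double q ⟩
    16 * q           ∎
    where
    open ≤-Reasoning
    double : ∀ q → q * 8 + q * 8 ≡ 16 * q
    double = solve-∀

theorem3p1 : ∃ λ (C : ℚ) → (0ℚ ℚ.< C) × ∃ λ (N : ℕ) →
    ∀ (n : ℕ) → n ≥ N → ∀ (A : OnlineAlgorithm n) →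
    ∃ λ (σ : List (Request n)) → ∃ λ (S : Schedule n) → ∃ λ (r : ℚ) →
    DelayFactor≤ S σ r × DelayFactor≥ (run A σ) σ (C ℚ.* toℚ n ℚ.* r)
theorem3p1 = C , C-pos , 8 , λ n 8≤n A →
  let open Adversary A (n / 8) (eighth-room n 8≤n)
  in σ , opt , 1ℚ , opt-delayFactor≤1 , online-delayFactor≥ (C*n≤K {K = n / 8} (n≤16*eighth n 8≤n))
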